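{- Let $G$ be an interval graph, $c\ge1$ and $k\ge0$ integers, and let $S$ and $S'$ be distinct $c$-colorable sets of size at least $k$ in $G$. Assume $S$ and $S'$ are both locked in $G[S \cup S']$ but neither is locked in $G$. If there is a vertex $v \in V(G)\setminus (S\cup S')$ such that both $S \cup\{v\}$ and $S'\cup\{v\}$ are $c$-colorable in $G$, then $\mathrm{dist}_{\mathsf{TAR}_k}(S,S') = |S \triangle S'| + 2$.
   Context: A set $S \subseteq V(H)$ is $c$-colorable in a graph $H$ if $H[S]$ has a proper $c$-coloring. For $c$-colorable sets $S,T$ of $G$, $S \leftrightarrow T$ under $\mathsf{TAR}_k$ means $|S|,|T|\ge k$ and $|S\triangle T|=1$. A $\mathsf{TAR}_k$-sequence of length $\ell$ is a sequence $\langle S_0,\dots,S_\ell\rangle$ of $c$-colorable sets of $G$ with $S_{i-1}\leftrightarrow S_i$ under $\mathsf{TAR}_k$; $\mathrm{dist}_{\mathsf{TAR}_k}(S,S')$ is the minimum length of such a sequence between $S$ and $S'$ in $G$ ($\infty$ if none). A $c$-colorable set $S$ is locked in a subgraph $H$ (here $H=G$ or $H=G[S\cup S']$) if it is an inclusion-maximal $c$-colorable set of $H$ and $|S|=k$. An interval graph is the intersection graph of closed intervals on the real line. -}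

module Defs where

open import Data.Nat using (ℕ; zero; suc; _≤_; _+_)
open import Data.Fin using (Fin)
open import Data.Fin.Subset using (Subset; _∈_; _⊆_; _∪_; _─_; ∣_∣; ⁅_⁆; ⊤)
open import Data.Product using (Σ; _×_; ∃)
open import Relation.Binary.PropositionalEquality using (_≡_; _≢_)

-- An interval graph on vertex set Fin n: vertex i is the closed interval
-- [ left i , right i ]; distinct vertices are adjacent iff their intervals intersect.
-- (For finitely many closed intervals, endpoints can be taken to be natural numbers
--  without changing the intersection pattern.)
record IntervalGraph (n : ℕ) : Set where
  field
    left  : Fin n → ℕ
    right : Fin n → ℕ
    valid : ∀ i → left i ≤ right i

module _ {n : ℕ} (G : IntervalGraph n) where
  open IntervalGraph G

  Adj : Fin n → Fin n → Set
  Adj i j = i ≢ j × (left i ≤ right j × left j ≤ right i)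

  Colorable : ℕ → Subset n → Set
  Colorable c S = Σ (Fin n → Fin c) λ f →
    ∀ i j → i ∈ S → j ∈ S → Adj i j → f i ≢ f j

  _△_ : Subset n → Subset n → Subset n
  S △ T = (S ─ T) ∪ (T ─ S)

  -- S is locked in the induced subgraph G[U] (U = ⊤ gives G itself):
  -- S is an inclusion-maximal c-colorable set of G[U] and |S| = k.
  -- (Colorability in G[U] of a set T ⊆ U coincides with colorability in G.)
  LockedIn : ℕ → ℕ → Subset n → Subset n → Set
  LockedIn c k U S =
    S ⊆ U × Colorable c S ×
    (∀ T → S ⊆ T → T ⊆ U → Colorable c T → T ⊆ S) ×
    ∣ S ∣ ≡ k

  TARStep : ℕ → Subset n → Subset n → Set
  TARStep k S T = k ≤ ∣ S ∣ × k ≤ ∣ T ∣ × ∣ S △ T ∣ ≡ 1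

  data TARSeq (c k : ℕ) (S : Subset n) : Subset n → ℕ → Set where
    start : Colorable c S → TARSeq c k S S 0
    step  : ∀ {T U ℓ} → TARSeq c k S T ℓ → Colorable c U → TARStep k T U →
            TARSeq c k S U (suc ℓ)

  DistTAR≡ : ℕ → ℕ → Subset n → Subset n → ℕ → Set
  DistTAR≡ c k S T d = TARSeq c k S T d × (∀ ℓ → TARSeq c k S T ℓ → d ≤ ℓ)

{-# OPTIONS --safe #-}

-- A set of intervals is c-colourable iff every point lies in at most c of them: colour
-- greedily, handling the interval that ends first last. Hence for c-colourable X ≠ T of equal
-- size there are a ∈ X ∖ T and b ∈ T ∖ X with X - a + b c-colourable: it suffices that every
-- point of b at which X has full load lies in a, and a left-to-right sweep over X ∖ T and
-- T ∖ X finds such a pair. Repeating this exchange, two TAR steps at a time, leads from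
-- S + v to S′ + v; with the steps S → S + v and S′ + v → S′ this gives a sequence of length
-- |S △ S′| + 2. Conversely, as |S| = k the first step from S adds some x, and x ∉ S′ because
-- S is maximal in G[S ∪ S′]; so at least |(S + x) △ S′| = |S △ S′| + 1 steps remain.

module Submission where

open import Defs
open import Data.Fin using (Fin)
open import Data.Nat using (ℕ; _≤_; _+_)
open import Data.Fin.Subset using (Subset; _∉_; _∪_; ∣_∣; ⁅_⁆; ⊤)
open import Data.Product using (Σ; _×_)
open import Relation.Binary.PropositionalEquality using (_≢_)
open import Relation.Nullary using (¬_)

open import Data.Bool using (Bool; true; false; _∧_; _∨_; not; _xor_)
open import Data.Bool.Properties using (∧-zeroʳ; ∧-identityʳ; ∨-identityʳ)
open import Data.Fin using (zero; suc; _≟_; fromℕ<)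
open import Data.Fin.Properties using (¬∀⟶∃¬; any?)
import Data.Fin.Properties as Fin
open import Data.Fin.Subset
open import Data.Fin.Subset.Properties
open import Data.List using (List; filter; allFin)
open import Data.List.Extrema.Nat using (argmin; argmin-all; f[argmin]≤f[xs])
open import Data.List.Membership.Propositional.Properties using (∈-filter⁺; ∈-filter⁻; ∈-allFin)
import Data.List.Relation.Unary.All as All
open import Data.Nat using (zero; suc; _<_; _≤?_; z≤n; s≤s)
open import Data.Nat.Properties hiding (_≟_)
open import Algebra.Properties.CommutativeSemigroup +-commutativeSemigroup using (interchange)
open import Data.Product using (_,_; proj₁; proj₂; ∃; ∃₂)
open import Data.Sum using (_⊎_; inj₁; inj₂)
open import Data.Vec using (_∷_; []; lookup; tabulate; here; there)
open import Data.Vec.Properties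
  using (lookup-zipWith; lookup-replicate; []=⇒lookup; lookup⇒[]=; lookup∘tabulate)
open import Data.Vec.Functional using (updateAt)
open import Data.Vec.Functional.Properties using (updateAt-updates; updateAt-minimal)
open import Function using (_∘_; const)
open import Relation.Binary.PropositionalEquality
open import Relation.Nullary using (Dec; yes; no; does; proof; contradiction)
open import Relation.Nullary.Decidable using (_×-dec_; dec-true; dec-false)
open import Relation.Nullary.Reflects using (Reflects; invert)
open import Relation.Unary using (Pred; Decidable)

private variable n : ℕ

𝟙 : Bool → ℕ
𝟙 true  = 1
𝟙 false = 0

∣b∷p∣≡𝟙[b]+∣p∣ : (b : Bool) (p : Subset n) → ∣ b ∷ p ∣ ≡ 𝟙 b + ∣ p ∣
∣b∷p∣≡𝟙[b]+∣p∣ true  p = refl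
∣b∷p∣≡𝟙[b]+∣p∣ false p = refl

∣p∣≡∣q∣+∣r∣-pointwise : (p q r : Subset n) →
  (∀ i → 𝟙 (lookup p i) ≡ 𝟙 (lookup q i) + 𝟙 (lookup r i)) → ∣ p ∣ ≡ ∣ q ∣ + ∣ r ∣
∣p∣≡∣q∣+∣r∣-pointwise []      []      []      _  = refl
∣p∣≡∣q∣+∣r∣-pointwise (a ∷ p) (b ∷ q) (c ∷ r) eq = begin
  ∣ a ∷ p ∣                       ≡⟨ ∣b∷p∣≡𝟙[b]+∣p∣ a p ⟩
  𝟙 a + ∣ p ∣                     ≡⟨ cong₂ _+_ (eq zero) (∣p∣≡∣q∣+∣r∣-pointwise p q r (eq ∘ suc)) ⟩
  (𝟙 b + 𝟙 c) + (∣ q ∣ + ∣ r ∣)   ≡⟨ interchange (𝟙 b) (𝟙 c) ∣ q ∣ ∣ r ∣ ⟩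
  (𝟙 b + ∣ q ∣) + (𝟙 c + ∣ r ∣)   ≡⟨ cong₂ _+_ (∣b∷p∣≡𝟙[b]+∣p∣ b q) (∣b∷p∣≡𝟙[b]+∣p∣ c r) ⟨
  ∣ b ∷ q ∣ + ∣ c ∷ r ∣           ∎
  where open ≡-Reasoning

∣p∣≤∣q∣+∣r∣-pointwise : (p q r : Subset n) →
  (∀ i → 𝟙 (lookup p i) ≤ 𝟙 (lookup q i) + 𝟙 (lookup r i)) → ∣ p ∣ ≤ ∣ q ∣ + ∣ r ∣
∣p∣≤∣q∣+∣r∣-pointwise []      []      []      _  = z≤n
∣p∣≤∣q∣+∣r∣-pointwise (a ∷ p) (b ∷ q) (c ∷ r) le = begin
  ∣ a ∷ p ∣                       ≡⟨ ∣b∷p∣≡𝟙[b]+∣p∣ a p ⟩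
  𝟙 a + ∣ p ∣                     ≤⟨ +-mono-≤ (le zero) (∣p∣≤∣q∣+∣r∣-pointwise p q r (le ∘ suc)) ⟩
  (𝟙 b + 𝟙 c) + (∣ q ∣ + ∣ r ∣)   ≡⟨ interchange (𝟙 b) (𝟙 c) ∣ q ∣ ∣ r ∣ ⟩
  (𝟙 b + ∣ q ∣) + (𝟙 c + ∣ r ∣)   ≡⟨ cong₂ _+_ (∣b∷p∣≡𝟙[b]+∣p∣ b q) (∣b∷p∣≡𝟙[b]+∣p∣ c r) ⟨
  ∣ b ∷ q ∣ + ∣ c ∷ r ∣           ∎
  where open ≤-Reasoning

lookup-∩ : (p q : Subset n) (i : Fin n) → lookup (p ∩ q) i ≡ lookup p i ∧ lookup q i
lookup-∩ p q i = lookup-zipWith _∧_ i p q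

lookup-∪ : (p q : Subset n) (i : Fin n) → lookup (p ∪ q) i ≡ lookup p i ∨ lookup q i
lookup-∪ p q i = lookup-zipWith _∨_ i p q

lookup-─ : (p q : Subset n) (i : Fin n) → lookup (p ─ q) i ≡ lookup p i ∧ not (lookup q i)
lookup-─ (a ∷ p) (true  ∷ q) zero    = sym (∧-zeroʳ a)
lookup-─ (a ∷ p) (false ∷ q) zero    = sym (∧-identityʳ a)
lookup-─ (_ ∷ p) (_     ∷ q) (suc i) = lookup-─ p q i

lookup-⊥ : (i : Fin n) → lookup ⊥ i ≡ false
lookup-⊥ i = lookup-replicate i false

lookup-⊤ : (i : Fin n) → lookup ⊤ i ≡ true
lookup-⊤ i = lookup-replicate i true

lookup-⁅⁆ : (x i : Fin n) → lookup ⁅ x ⁆ i ≡ does (i ≟ x)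
lookup-⁅⁆ zero    zero    = refl
lookup-⁅⁆ zero    (suc i) = lookup-⊥ i
lookup-⁅⁆ (suc x) zero    = refl
lookup-⁅⁆ (suc x) (suc i) = lookup-⁅⁆ x i

∈⇒lookup≡true : {x : Fin n} {p : Subset n} → x ∈ p → lookup p x ≡ true
∈⇒lookup≡true = []=⇒lookup

lookup≡true⇒∈ : {x : Fin n} {p : Subset n} → lookup p x ≡ true → x ∈ p
lookup≡true⇒∈ {x = x} {p} = lookup⇒[]= x p

∉⇒lookup≡false : {x : Fin n} {p : Subset n} → x ∉ p → lookup p x ≡ false
∉⇒lookup≡false {x = x} {p} x∉p with lookup p x in eq
... | true  = contradiction (lookup≡true⇒∈ eq) x∉p
... | false = refl

x∈p─q⇒x∉q : {x : Fin n} {p q : Subset n} → x ∈ p ─ q → x ∉ q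
x∈p─q⇒x∉q {p = _ ∷ p} {false ∷ q} here        ()
x∈p─q⇒x∉q {p = _ ∷ p} {_     ∷ q} (there x∈) (there x∈q) = x∈p─q⇒x∉q x∈ x∈q

x∉p-x : {x : Fin n} {p : Subset n} → x ∉ p - x
x∉p-x {x = x} x∈p-x = x∈p─q⇒x∉q x∈p-x (x∈⁅x⁆ x)

x∈p∪⁅x⁆ : {x : Fin n} (p : Subset n) → x ∈ p ∪ ⁅ x ⁆
x∈p∪⁅x⁆ {x = x} p = q⊆p∪q p ⁅ x ⁆ (x∈⁅x⁆ x)

x∈p⇒0<∣p∣ : {x : Fin n} {p : Subset n} → x ∈ p → 0 < ∣ p ∣
x∈p⇒0<∣p∣ {x = x} x∈p = subst (_≤ _) (∣⁅x⁆∣≡1 x)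
  (p⊆q⇒∣p∣≤∣q∣ λ y∈⁅x⁆ → subst (_∈ _) (sym (x∈⁅y⁆⇒x≡y x y∈⁅x⁆)) x∈p)

0<∣p∣⇒Nonempty : (p : Subset n) → 0 < ∣ p ∣ → Nonempty p
0<∣p∣⇒Nonempty (true  ∷ p) _     = zero , here
0<∣p∣⇒Nonempty (false ∷ p) 0<∣p∣ with x , x∈p ← 0<∣p∣⇒Nonempty p 0<∣p∣ = suc x , there x∈p

∣p─q∣≡0⇒p⊆q : (p q : Subset n) → ∣ p ─ q ∣ ≡ 0 → p ⊆ q
∣p─q∣≡0⇒p⊆q p q ∣p─q∣≡0 {x} x∈p with x ∈? q
... | yes x∈q = x∈q
... | no  x∉q = contradiction (subst (0 <_) ∣p─q∣≡0 (x∈p⇒0<∣p∣ (x∈p∧x∉q⇒x∈p─q x∈p x∉q))) (<-irrefl refl)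

∣p∣≤1⇒∈-unique : {p : Subset n} {x y : Fin n} → ∣ p ∣ ≤ 1 → x ∈ p → y ∈ p → x ≡ y
∣p∣≤1⇒∈-unique {p = p} {x} {y} ∣p∣≤1 x∈p y∈p with x ≟ y
... | yes x≡y = x≡y
... | no  x≢y = contradiction (<-≤-trans 1<∣p∣ ∣p∣≤1) (<-irrefl refl)
  where
  1<∣p∣ : 1 < ∣ p ∣
  1<∣p∣ = ≤-<-trans (x∈p⇒0<∣p∣ (x∈p∧x≢y⇒x∈p-y y∈p (x≢y ∘ sym))) (x∈p⇒∣p-x∣<∣p∣ x∈p)

∣p∩r∣≡∣p∩q∩r∣+∣p─q∩r∣ : (p q r : Subset n) → ∣ p ∩ r ∣ ≡ ∣ (p ∩ q) ∩ r ∣ + ∣ (p ─ q) ∩ r ∣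
∣p∩r∣≡∣p∩q∩r∣+∣p─q∩r∣ p q r = ∣p∣≡∣q∣+∣r∣-pointwise (p ∩ r) ((p ∩ q) ∩ r) ((p ─ q) ∩ r) bits
  where
  bits : ∀ i → 𝟙 (lookup (p ∩ r) i) ≡ 𝟙 (lookup ((p ∩ q) ∩ r) i) + 𝟙 (lookup ((p ─ q) ∩ r) i)
  bits i rewrite lookup-∩ p r i | lookup-∩ (p ∩ q) r i | lookup-∩ p q i
               | lookup-∩ (p ─ q) r i | lookup-─ p q i
    with lookup p i | lookup q i | lookup r i
  ... | false | _     | _     = refl
  ... | true  | true  | true  = refl
  ... | true  | true  | false = refl
  ... | true  | false | true  = refl
  ... | true  | false | false = refl

∣p∣≡∣p∩q∣+∣p─q∣ : (p q : Subset n) → ∣ p ∣ ≡ ∣ p ∩ q ∣ + ∣ p ─ q ∣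
∣p∣≡∣p∩q∣+∣p─q∣ p q = begin
  ∣ p ∣                               ≡⟨ cong ∣_∣ (∩-identityʳ p) ⟨
  ∣ p ∩ ⊤ ∣                           ≡⟨ ∣p∩r∣≡∣p∩q∩r∣+∣p─q∩r∣ p q ⊤ ⟩
  ∣ (p ∩ q) ∩ ⊤ ∣ + ∣ (p ─ q) ∩ ⊤ ∣   ≡⟨ cong₂ (λ s t → ∣ s ∣ + ∣ t ∣) (∩-identityʳ (p ∩ q)) (∩-identityʳ (p ─ q)) ⟩
  ∣ p ∩ q ∣ + ∣ p ─ q ∣               ∎
  where open ≡-Reasoning

∣p∣≤∣q∣⇒∣p─q∣≤∣q─p∣ : (p q : Subset n) → ∣ p ∣ ≤ ∣ q ∣ → ∣ p ─ q ∣ ≤ ∣ q ─ p ∣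
∣p∣≤∣q∣⇒∣p─q∣≤∣q─p∣ p q ∣p∣≤∣q∣ = +-cancelˡ-≤ ∣ p ∩ q ∣ _ _ (begin
  ∣ p ∩ q ∣ + ∣ p ─ q ∣   ≡⟨ ∣p∣≡∣p∩q∣+∣p─q∣ p q ⟨
  ∣ p ∣                   ≤⟨ ∣p∣≤∣q∣ ⟩
  ∣ q ∣                   ≡⟨ ∣p∣≡∣p∩q∣+∣p─q∣ q p ⟩
  ∣ q ∩ p ∣ + ∣ q ─ p ∣   ≡⟨ cong (λ s → ∣ s ∣ + ∣ q ─ p ∣) (∩-comm q p) ⟩
  ∣ p ∩ q ∣ + ∣ q ─ p ∣   ∎)
  where open ≤-Reasoning

∣p∣≡∣q∣⇒∣p─q∣≡∣q─p∣ : (p q : Subset n) → ∣ p ∣ ≡ ∣ q ∣ → ∣ p ─ q ∣ ≡ ∣ q ─ p ∣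
∣p∣≡∣q∣⇒∣p─q∣≡∣q─p∣ p q ∣p∣≡∣q∣ =
  ≤-antisym (∣p∣≤∣q∣⇒∣p─q∣≤∣q─p∣ p q (≤-reflexive ∣p∣≡∣q∣))
            (∣p∣≤∣q∣⇒∣p─q∣≤∣q─p∣ q p (≤-reflexive (sym ∣p∣≡∣q∣)))

∣p∣≡∣q∣∧p≢q⇒Nonempty[q─p] : (p q : Subset n) → ∣ p ∣ ≡ ∣ q ∣ → p ≢ q → Nonempty (q ─ p)
∣p∣≡∣q∣∧p≢q⇒Nonempty[q─p] p q ∣p∣≡∣q∣ p≢q = 0<∣p∣⇒Nonempty (q ─ p) (n≢0⇒n>0 λ ∣q─p∣≡0 →
  p≢q (⊆-antisym (∣p─q∣≡0⇒p⊆q p q (trans (∣p∣≡∣q∣⇒∣p─q∣≡∣q─p∣ p q ∣p∣≡∣q∣) ∣q─p∣≡0))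
                 (∣p─q∣≡0⇒p⊆q q p ∣q─p∣≡0)))

∣⁅x⁆∩p∣≡𝟙[x∈p] : (x : Fin n) (p : Subset n) → ∣ ⁅ x ⁆ ∩ p ∣ ≡ 𝟙 (lookup p x)
∣⁅x⁆∩p∣≡𝟙[x∈p] {suc n} zero    (true  ∷ p) = cong suc (trans (cong ∣_∣ (∩-zeroˡ p)) (∣⊥∣≡0 n))
∣⁅x⁆∩p∣≡𝟙[x∈p] {suc n} zero    (false ∷ p) = trans (cong ∣_∣ (∩-zeroˡ p)) (∣⊥∣≡0 n)
∣⁅x⁆∩p∣≡𝟙[x∈p]         (suc x) (_     ∷ p) = ∣⁅x⁆∩p∣≡𝟙[x∈p] x p

∣p∩r∣≡∣p-x∩r∣+𝟙[x∈r] : {x : Fin n} {p : Subset n} → x ∈ p → (r : Subset n) →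
  ∣ p ∩ r ∣ ≡ ∣ (p - x) ∩ r ∣ + 𝟙 (lookup r x)
∣p∩r∣≡∣p-x∩r∣+𝟙[x∈r] {x = x} {p} x∈p r =
  trans (∣p∣≡∣q∣+∣r∣-pointwise (p ∩ r) ((p - x) ∩ r) (⁅ x ⁆ ∩ r) bits)
        (cong (∣ (p - x) ∩ r ∣ +_) (∣⁅x⁆∩p∣≡𝟙[x∈p] x r))
  where
  bits : ∀ i → 𝟙 (lookup (p ∩ r) i) ≡ 𝟙 (lookup ((p - x) ∩ r) i) + 𝟙 (lookup (⁅ x ⁆ ∩ r) i)
  bits i rewrite lookup-∩ p r i | lookup-∩ (p - x) r i | lookup-∩ ⁅ x ⁆ r i
               | lookup-─ p ⁅ x ⁆ i | lookup-⁅⁆ x i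
    with i ≟ x
  ... | yes refl rewrite ∈⇒lookup≡true x∈p = refl
  ... | no  _    rewrite ∧-identityʳ (lookup p i) = sym (+-identityʳ _)

∣p∪⁅x⁆∩r∣≡∣p∩r∣+𝟙[x∈r] : {x : Fin n} {p : Subset n} → x ∉ p → (r : Subset n) →
  ∣ (p ∪ ⁅ x ⁆) ∩ r ∣ ≡ ∣ p ∩ r ∣ + 𝟙 (lookup r x)
∣p∪⁅x⁆∩r∣≡∣p∩r∣+𝟙[x∈r] {x = x} {p} x∉p r =
  trans (∣p∣≡∣q∣+∣r∣-pointwise ((p ∪ ⁅ x ⁆) ∩ r) (p ∩ r) (⁅ x ⁆ ∩ r) bits)
        (cong (∣ p ∩ r ∣ +_) (∣⁅x⁆∩p∣≡𝟙[x∈p] x r))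
  where
  bits : ∀ i → 𝟙 (lookup ((p ∪ ⁅ x ⁆) ∩ r) i) ≡ 𝟙 (lookup (p ∩ r) i) + 𝟙 (lookup (⁅ x ⁆ ∩ r) i)
  bits i rewrite lookup-∩ (p ∪ ⁅ x ⁆) r i | lookup-∩ p r i | lookup-∩ ⁅ x ⁆ r i
               | lookup-∪ p ⁅ x ⁆ i | lookup-⁅⁆ x i
    with i ≟ x
  ... | yes refl rewrite ∉⇒lookup≡false x∉p = refl
  ... | no  _    rewrite ∨-identityʳ (lookup p i) = sym (+-identityʳ _)

∣p∣≡1+∣p-x∣ : {x : Fin n} {p : Subset n} → x ∈ p → ∣ p ∣ ≡ suc ∣ p - x ∣
∣p∣≡1+∣p-x∣ {x = x} {p} x∈p = begin
  ∣ p ∣                              ≡⟨ cong ∣_∣ (∩-identityʳ p) ⟨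
  ∣ p ∩ ⊤ ∣                          ≡⟨ ∣p∩r∣≡∣p-x∩r∣+𝟙[x∈r] x∈p ⊤ ⟩
  ∣ (p - x) ∩ ⊤ ∣ + 𝟙 (lookup ⊤ x)   ≡⟨ cong₂ (λ s b → ∣ s ∣ + 𝟙 b) (∩-identityʳ (p - x)) (lookup-⊤ x) ⟩
  ∣ p - x ∣ + 1                      ≡⟨ +-comm ∣ p - x ∣ 1 ⟩
  suc ∣ p - x ∣                      ∎
  where open ≡-Reasoning

∣p∪⁅x⁆∣≡1+∣p∣ : {x : Fin n} {p : Subset n} → x ∉ p → ∣ p ∪ ⁅ x ⁆ ∣ ≡ suc ∣ p ∣
∣p∪⁅x⁆∣≡1+∣p∣ {x = x} {p} x∉p = begin
  ∣ p ∪ ⁅ x ⁆ ∣                  ≡⟨ cong ∣_∣ (∩-identityʳ (p ∪ ⁅ x ⁆)) ⟨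
  ∣ (p ∪ ⁅ x ⁆) ∩ ⊤ ∣            ≡⟨ ∣p∪⁅x⁆∩r∣≡∣p∩r∣+𝟙[x∈r] x∉p ⊤ ⟩
  ∣ p ∩ ⊤ ∣ + 𝟙 (lookup ⊤ x)     ≡⟨ cong₂ (λ s b → ∣ s ∣ + 𝟙 b) (∩-identityʳ p) (lookup-⊤ x) ⟩
  ∣ p ∣ + 1                      ≡⟨ +-comm ∣ p ∣ 1 ⟩
  suc ∣ p ∣                      ∎
  where open ≡-Reasoning

∣p∣≤∣q∣⇒∣p-x∣≤∣q-y∣ : {x y : Fin n} {p q : Subset n} → x ∈ p → y ∈ q →
  ∣ p ∣ ≤ ∣ q ∣ → ∣ p - x ∣ ≤ ∣ q - y ∣
∣p∣≤∣q∣⇒∣p-x∣≤∣q-y∣ x∈p y∈q ∣p∣≤∣q∣ = ≤-pred (subst₂ _≤_ (∣p∣≡1+∣p-x∣ x∈p) (∣p∣≡1+∣p-x∣ y∈q) ∣p∣≤∣q∣)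

∣p∪q∣≤∣p∣+∣q∣ : (p q : Subset n) → ∣ p ∪ q ∣ ≤ ∣ p ∣ + ∣ q ∣
∣p∪q∣≤∣p∣+∣q∣ p q = ∣p∣≤∣q∣+∣r∣-pointwise (p ∪ q) p q bits
  where
  bits : ∀ i → 𝟙 (lookup (p ∪ q) i) ≤ 𝟙 (lookup p i) + 𝟙 (lookup q i)
  bits i rewrite lookup-∪ p q i with lookup p i | lookup q i
  ... | true  | _ = s≤s z≤n
  ... | false | _ = ≤-refl

injectiveOn∧avoids⇒∣p∣+∣q∣≤m : ∀ {m} (p : Subset n) (q : Subset m) (f : Fin n → Fin m) →
  (∀ i j → i ∈ p → j ∈ p → i ≢ j → f i ≢ f j) → (∀ i → i ∈ p → f i ∉ q) → ∣ p ∣ + ∣ q ∣ ≤ m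
injectiveOn∧avoids⇒∣p∣+∣q∣≤m []          q f _   _     = ∣p∣≤n q
injectiveOn∧avoids⇒∣p∣+∣q∣≤m (false ∷ p) q f inj avoid =
  injectiveOn∧avoids⇒∣p∣+∣q∣≤m p q (f ∘ suc)
    (λ i j i∈p j∈p i≢j → inj (suc i) (suc j) (there i∈p) (there j∈p) (i≢j ∘ Fin.suc-injective))
    (λ i i∈p → avoid (suc i) (there i∈p))
injectiveOn∧avoids⇒∣p∣+∣q∣≤m {m = m} (true ∷ p) q f inj avoid = begin
  suc ∣ p ∣ + ∣ q ∣            ≡⟨ +-suc ∣ p ∣ ∣ q ∣ ⟨
  ∣ p ∣ + suc ∣ q ∣            ≡⟨ cong (∣ p ∣ +_) (∣p∪⁅x⁆∣≡1+∣p∣ (avoid zero here)) ⟨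
  ∣ p ∣ + ∣ q ∪ ⁅ f zero ⁆ ∣   ≤⟨ injectiveOn∧avoids⇒∣p∣+∣q∣≤m p (q ∪ ⁅ f zero ⁆) (f ∘ suc) inj′ avoid′ ⟩
  m                            ∎
  where
  open ≤-Reasoning
  inj′ : ∀ i j → i ∈ p → j ∈ p → i ≢ j → f (suc i) ≢ f (suc j)
  inj′ i j i∈p j∈p i≢j = inj (suc i) (suc j) (there i∈p) (there j∈p) (i≢j ∘ Fin.suc-injective)
  avoid′ : ∀ i → i ∈ p → f (suc i) ∉ q ∪ ⁅ f zero ⁆
  avoid′ i i∈p fi∈ with x∈p∪q⁻ q ⁅ f zero ⁆ fi∈
  ... | inj₁ fi∈q    = avoid (suc i) (there i∈p) fi∈q
  ... | inj₂ fi∈⁅f0⁆ = inj (suc i) zero (there i∈p) here (λ ()) (x∈⁅y⁆⇒x≡y (f zero) fi∈⁅f0⁆)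

∣q∣<m⇒∃∉q : ∀ {m} (q : Subset m) → ∣ q ∣ < m → ∃ λ γ → γ ∉ q
∣q∣<m⇒∃∉q {m} q ∣q∣<m = ¬∀⟶∃¬ m (_∈ q) (_∈? q) λ all∈q →
  <⇒≱ ∣q∣<m (subst (_≤ ∣ q ∣) (∣⊤∣≡n m) (p⊆q⇒∣p∣≤∣q∣ {p = ⊤} (λ {γ} _ → all∈q γ)))

∣p∣+∣q∣<m⇒∃∉q∪f[p] : ∀ {m} (p : Subset n) (q : Subset m) (f : Fin n → Fin m) →
  ∣ p ∣ + ∣ q ∣ < m → ∃ λ γ → γ ∉ q × (∀ i → i ∈ p → f i ≢ γ)
∣p∣+∣q∣<m⇒∃∉q∪f[p] []          q f ∣q∣<m with γ , γ∉q ← ∣q∣<m⇒∃∉q q ∣q∣<m = γ , γ∉q , λ _ ()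
∣p∣+∣q∣<m⇒∃∉q∪f[p] (false ∷ p) q f bound
  with γ , γ∉q , missed ← ∣p∣+∣q∣<m⇒∃∉q∪f[p] p q (f ∘ suc) bound
  = γ , γ∉q , λ { (suc i) (there i∈p) → missed i i∈p }
∣p∣+∣q∣<m⇒∃∉q∪f[p] {m = m} (true ∷ p) q f bound =
  extend (∣p∣+∣q∣<m⇒∃∉q∪f[p] p (q ∪ ⁅ f zero ⁆) (f ∘ suc) bound′)
  where
  extend : (∃ λ γ → γ ∉ q ∪ ⁅ f zero ⁆ × (∀ i → i ∈ p → f (suc i) ≢ γ)) →
           ∃ λ γ → γ ∉ q × (∀ i → i ∈ true ∷ p → f i ≢ γ)
  extend (γ , γ∉q′ , missed) = γ , γ∉q′ ∘ p⊆p∪q ⁅ f zero ⁆ ,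
    λ { zero    here        f0≡γ → γ∉q′ (subst (_∈ q ∪ ⁅ f zero ⁆) f0≡γ (x∈p∪⁅x⁆ q))
      ; (suc i) (there i∈p)      → missed i i∈p }
  bound′ : ∣ p ∣ + ∣ q ∪ ⁅ f zero ⁆ ∣ < m
  bound′ = begin-strict
    ∣ p ∣ + ∣ q ∪ ⁅ f zero ⁆ ∣         ≤⟨ +-monoʳ-≤ ∣ p ∣ (∣p∪q∣≤∣p∣+∣q∣ q ⁅ f zero ⁆) ⟩
    ∣ p ∣ + (∣ q ∣ + ∣ ⁅ f zero ⁆ ∣)   ≡⟨ cong (λ s → ∣ p ∣ + (∣ q ∣ + s)) (∣⁅x⁆∣≡1 (f zero)) ⟩
    ∣ p ∣ + (∣ q ∣ + 1)                ≡⟨ cong (∣ p ∣ +_) (+-comm ∣ q ∣ 1) ⟩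
    ∣ p ∣ + suc ∣ q ∣                  ≡⟨ +-suc ∣ p ∣ ∣ q ∣ ⟩
    suc ∣ p ∣ + ∣ q ∣                  <⟨ bound ⟩
    m                                  ∎
    where open ≤-Reasoning

-- The symmetric difference `_△_ G` of Defs, without its unused graph argument.
infixl 6 _⊖_

_⊖_ : Subset n → Subset n → Subset n
p ⊖ q = (p ─ q) ∪ (q ─ p)

lookup-⊖ : (p q : Subset n) (i : Fin n) → lookup (p ⊖ q) i ≡ lookup p i xor lookup q i
lookup-⊖ p q i rewrite lookup-∪ (p ─ q) (q ─ p) i | lookup-─ p q i | lookup-─ q p i
  with lookup p i | lookup q i
... | true  | true  = refl
... | true  | false = refl
... | false | true  = refl
... | false | false = refl

∣p⊖q∣≡∣p─q∣+∣q─p∣ : (p q : Subset n) → ∣ p ⊖ q ∣ ≡ ∣ p ─ q ∣ + ∣ q ─ p ∣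
∣p⊖q∣≡∣p─q∣+∣q─p∣ p q = ∣p∣≡∣q∣+∣r∣-pointwise (p ⊖ q) (p ─ q) (q ─ p) bits
  where
  bits : ∀ i → 𝟙 (lookup (p ⊖ q) i) ≡ 𝟙 (lookup (p ─ q) i) + 𝟙 (lookup (q ─ p) i)
  bits i rewrite lookup-⊖ p q i | lookup-─ p q i | lookup-─ q p i with lookup p i | lookup q i
  ... | true  | true  = refl
  ... | true  | false = refl
  ... | false | true  = refl
  ... | false | false = refl

∣p⊖p∣≡0 : (p : Subset n) → ∣ p ⊖ p ∣ ≡ 0
∣p⊖p∣≡0 {n} p = n≤0⇒n≡0 (begin
  ∣ p ⊖ p ∣               ≤⟨ ∣p∣≤∣q∣+∣r∣-pointwise (p ⊖ p) ⊥ ⊥ bits ⟩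
  ∣ ⊥ {n} ∣ + ∣ ⊥ {n} ∣   ≡⟨ cong₂ _+_ (∣⊥∣≡0 n) (∣⊥∣≡0 n) ⟩
  0                       ∎)
  where
  open ≤-Reasoning
  bits : ∀ i → 𝟙 (lookup (p ⊖ p) i) ≤ 𝟙 (lookup ⊥ i) + 𝟙 (lookup ⊥ i)
  bits i rewrite lookup-⊖ p p i | lookup-⊥ {n} i with lookup p i
  ... | true  = z≤n
  ... | false = z≤n

∣p⊖q∣≡0⇒p≡q : (p q : Subset n) → ∣ p ⊖ q ∣ ≡ 0 → p ≡ q
∣p⊖q∣≡0⇒p≡q p q ∣p⊖q∣≡0 =
  ⊆-antisym (∣p─q∣≡0⇒p⊆q p q (m+n≡0⇒m≡0 _ sum≡0)) (∣p─q∣≡0⇒p⊆q q p (m+n≡0⇒n≡0 _ sum≡0))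
  where
  sum≡0 : ∣ p ─ q ∣ + ∣ q ─ p ∣ ≡ 0
  sum≡0 = trans (sym (∣p⊖q∣≡∣p─q∣+∣q─p∣ p q)) ∣p⊖q∣≡0

∣p⊖q∣≡∣q⊖p∣ : (p q : Subset n) → ∣ p ⊖ q ∣ ≡ ∣ q ⊖ p ∣
∣p⊖q∣≡∣q⊖p∣ p q = cong ∣_∣ (∪-comm (p ─ q) (q ─ p))

∣p⊖r∣≤∣p⊖q∣+∣q⊖r∣ : (p q r : Subset n) → ∣ p ⊖ r ∣ ≤ ∣ p ⊖ q ∣ + ∣ q ⊖ r ∣
∣p⊖r∣≤∣p⊖q∣+∣q⊖r∣ p q r = ∣p∣≤∣q∣+∣r∣-pointwise (p ⊖ r) (p ⊖ q) (q ⊖ r) bits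
  where
  bits : ∀ i → 𝟙 (lookup (p ⊖ r) i) ≤ 𝟙 (lookup (p ⊖ q) i) + 𝟙 (lookup (q ⊖ r) i)
  bits i rewrite lookup-⊖ p r i | lookup-⊖ p q i | lookup-⊖ q r i
    with lookup p i | lookup q i | lookup r i
  ... | true  | true  | true  = z≤n
  ... | true  | true  | false = s≤s z≤n
  ... | true  | false | true  = z≤n
  ... | true  | false | false = s≤s z≤n
  ... | false | true  | true  = s≤s z≤n
  ... | false | true  | false = z≤n
  ... | false | false | true  = s≤s z≤n
  ... | false | false | false = z≤n

∣p⊖q∣≡1+∣p-x⊖q∣ : {x : Fin n} {p q : Subset n} → x ∈ p → x ∉ q → ∣ p ⊖ q ∣ ≡ suc ∣ (p - x) ⊖ q ∣
∣p⊖q∣≡1+∣p-x⊖q∣ {x = x} {p} {q} x∈p x∉q =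
  trans (∣p∣≡∣q∣+∣r∣-pointwise (p ⊖ q) ((p - x) ⊖ q) ⁅ x ⁆ bits)
        (trans (cong (∣ (p - x) ⊖ q ∣ +_) (∣⁅x⁆∣≡1 x)) (+-comm _ 1))
  where
  bits : ∀ i → 𝟙 (lookup (p ⊖ q) i) ≡ 𝟙 (lookup ((p - x) ⊖ q) i) + 𝟙 (lookup ⁅ x ⁆ i)
  bits i rewrite lookup-⊖ p q i | lookup-⊖ (p - x) q i | lookup-─ p ⁅ x ⁆ i | lookup-⁅⁆ x i
    with i ≟ x
  ... | yes refl rewrite ∈⇒lookup≡true x∈p | ∉⇒lookup≡false x∉q = refl
  ... | no  _    rewrite ∧-identityʳ (lookup p i) = sym (+-identityʳ _)

∣p⊖q∣≡1+∣p∪⁅x⁆⊖q∣ : {x : Fin n} {p q : Subset n} → x ∉ p → x ∈ q → ∣ p ⊖ q ∣ ≡ suc ∣ (p ∪ ⁅ x ⁆) ⊖ q ∣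
∣p⊖q∣≡1+∣p∪⁅x⁆⊖q∣ {x = x} {p} {q} x∉p x∈q =
  trans (∣p∣≡∣q∣+∣r∣-pointwise (p ⊖ q) ((p ∪ ⁅ x ⁆) ⊖ q) ⁅ x ⁆ bits)
        (trans (cong (∣ (p ∪ ⁅ x ⁆) ⊖ q ∣ +_) (∣⁅x⁆∣≡1 x)) (+-comm _ 1))
  where
  bits : ∀ i → 𝟙 (lookup (p ⊖ q) i) ≡ 𝟙 (lookup ((p ∪ ⁅ x ⁆) ⊖ q) i) + 𝟙 (lookup ⁅ x ⁆ i)
  bits i rewrite lookup-⊖ p q i | lookup-⊖ (p ∪ ⁅ x ⁆) q i | lookup-∪ p ⁅ x ⁆ i | lookup-⁅⁆ x i
    with i ≟ x
  ... | yes refl rewrite ∉⇒lookup≡false x∉p | ∈⇒lookup≡true x∈q = refl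
  ... | no  _    rewrite ∨-identityʳ (lookup p i) = sym (+-identityʳ _)

∣p∪⁅x⁆⊖q∣≡1+∣p⊖q∣ : {x : Fin n} {p q : Subset n} → x ∉ p → x ∉ q → ∣ (p ∪ ⁅ x ⁆) ⊖ q ∣ ≡ suc ∣ p ⊖ q ∣
∣p∪⁅x⁆⊖q∣≡1+∣p⊖q∣ {x = x} {p} {q} x∉p x∉q =
  trans (∣p∣≡∣q∣+∣r∣-pointwise ((p ∪ ⁅ x ⁆) ⊖ q) (p ⊖ q) ⁅ x ⁆ bits)
        (trans (cong (∣ p ⊖ q ∣ +_) (∣⁅x⁆∣≡1 x)) (+-comm _ 1))
  where
  bits : ∀ i → 𝟙 (lookup ((p ∪ ⁅ x ⁆) ⊖ q) i) ≡ 𝟙 (lookup (p ⊖ q) i) + 𝟙 (lookup ⁅ x ⁆ i)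
  bits i rewrite lookup-⊖ (p ∪ ⁅ x ⁆) q i | lookup-⊖ p q i | lookup-∪ p ⁅ x ⁆ i | lookup-⁅⁆ x i
    with i ≟ x
  ... | yes refl rewrite ∉⇒lookup≡false x∉p | ∉⇒lookup≡false x∉q = refl
  ... | no  _    rewrite ∨-identityʳ (lookup p i) = sym (+-identityʳ _)

∣p⊖p-x∣≡1 : {x : Fin n} {p : Subset n} → x ∈ p → ∣ p ⊖ (p - x) ∣ ≡ 1
∣p⊖p-x∣≡1 {x = x} {p} x∈p = trans (∣p⊖q∣≡1+∣p-x⊖q∣ x∈p x∉p-x) (cong suc (∣p⊖p∣≡0 (p - x)))

∣p⊖p∪⁅x⁆∣≡1 : {x : Fin n} {p : Subset n} → x ∉ p → ∣ p ⊖ (p ∪ ⁅ x ⁆) ∣ ≡ 1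
∣p⊖p∪⁅x⁆∣≡1 {x = x} {p} x∉p =
  trans (∣p⊖q∣≡1+∣p∪⁅x⁆⊖q∣ x∉p (x∈p∪⁅x⁆ p)) (cong suc (∣p⊖p∣≡0 (p ∪ ⁅ x ⁆)))

∣p∪⁅x⁆⊖q∪⁅x⁆∣≡∣p⊖q∣ : {x : Fin n} {p q : Subset n} → x ∉ p → x ∉ q →
  ∣ (p ∪ ⁅ x ⁆) ⊖ (q ∪ ⁅ x ⁆) ∣ ≡ ∣ p ⊖ q ∣
∣p∪⁅x⁆⊖q∪⁅x⁆∣≡∣p⊖q∣ {x = x} {p} {q} x∉p x∉q = suc-injective (begin
  suc ∣ (p ∪ ⁅ x ⁆) ⊖ (q ∪ ⁅ x ⁆) ∣   ≡⟨ ∣p⊖q∣≡1+∣p∪⁅x⁆⊖q∣ x∉p (x∈p∪⁅x⁆ q) ⟨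
  ∣ p ⊖ (q ∪ ⁅ x ⁆) ∣                 ≡⟨ ∣p⊖q∣≡∣q⊖p∣ p (q ∪ ⁅ x ⁆) ⟩
  ∣ (q ∪ ⁅ x ⁆) ⊖ p ∣                 ≡⟨ ∣p∪⁅x⁆⊖q∣≡1+∣p⊖q∣ x∉q x∉p ⟩
  suc ∣ q ⊖ p ∣                       ≡⟨ cong suc (∣p⊖q∣≡∣q⊖p∣ q p) ⟩
  suc ∣ p ⊖ q ∣                       ∎)
  where open ≡-Reasoning

m≤n⇒m+n≡1⇒m≡0 : ∀ {m n} → m ≤ n → m + n ≡ 1 → m ≡ 0
m≤n⇒m+n≡1⇒m≡0 {zero}          _ _  = refl
m≤n⇒m+n≡1⇒m≡0 {suc m} {suc n} _ eq = contradiction (trans (sym (+-suc m n)) (suc-injective eq)) λ ()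

∣p∣≤∣q∣∧∣p⊖q∣≡1⇒q≡p∪⁅x⁆ : {p q : Subset n} → ∣ p ∣ ≤ ∣ q ∣ → ∣ p ⊖ q ∣ ≡ 1 →
  ∃ λ x → x ∉ p × q ≡ p ∪ ⁅ x ⁆
∣p∣≤∣q∣∧∣p⊖q∣≡1⇒q≡p∪⁅x⁆ {n} {p} {q} ∣p∣≤∣q∣ ∣p⊖q∣≡1 =
  x , x∈p─q⇒x∉q x∈q─p , ⊆-antisym q⊆p∪⁅x⁆ p∪⁅x⁆⊆q
  where
  ∣p─q∣+∣q─p∣≡1 : ∣ p ─ q ∣ + ∣ q ─ p ∣ ≡ 1
  ∣p─q∣+∣q─p∣≡1 = trans (sym (∣p⊖q∣≡∣p─q∣+∣q─p∣ p q)) ∣p⊖q∣≡1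
  ∣p─q∣≡0 : ∣ p ─ q ∣ ≡ 0
  ∣p─q∣≡0 = m≤n⇒m+n≡1⇒m≡0 (∣p∣≤∣q∣⇒∣p─q∣≤∣q─p∣ p q ∣p∣≤∣q∣) ∣p─q∣+∣q─p∣≡1
  ∣q─p∣≡1 : ∣ q ─ p ∣ ≡ 1
  ∣q─p∣≡1 = trans (sym (cong (_+ ∣ q ─ p ∣) ∣p─q∣≡0)) ∣p─q∣+∣q─p∣≡1
  q─p-nonempty : Nonempty (q ─ p)
  q─p-nonempty = 0<∣p∣⇒Nonempty (q ─ p) (≤-reflexive (sym ∣q─p∣≡1))
  x : Fin n
  x = proj₁ q─p-nonempty
  x∈q─p : x ∈ q ─ p
  x∈q─p = proj₂ q─p-nonempty
  q⊆p∪⁅x⁆ : q ⊆ p ∪ ⁅ x ⁆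
  q⊆p∪⁅x⁆ {i} i∈q with i ∈? p
  ... | yes i∈p = p⊆p∪q ⁅ x ⁆ i∈p
  ... | no  i∉p = subst (_∈ p ∪ ⁅ x ⁆)
    (∣p∣≤1⇒∈-unique (≤-reflexive ∣q─p∣≡1) x∈q─p (x∈p∧x∉q⇒x∈p─q i∈q i∉p)) (x∈p∪⁅x⁆ p)
  p∪⁅x⁆⊆q : p ∪ ⁅ x ⁆ ⊆ q
  p∪⁅x⁆⊆q i∈p∪⁅x⁆ with x∈p∪q⁻ p ⁅ x ⁆ i∈p∪⁅x⁆
  ... | inj₁ i∈p   = ∣p─q∣≡0⇒p⊆q p q ∣p─q∣≡0 i∈p
  ... | inj₂ i∈⁅x⁆ = subst (_∈ q) (sym (x∈⁅y⁆⇒x≡y x i∈⁅x⁆)) (p─q⊆p q p x∈q─p)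

minimiser : ∀ {n ℓ} {P : Pred (Fin n) ℓ} → Decidable P → (f : Fin n → ℕ) →
  ∃ P → ∃ λ x → P x × (∀ y → P y → f x ≤ f y)
minimiser {n} P? f (x₀ , Px₀) =
  argmin f x₀ candidates ,
  argmin-all f Px₀ (All.tabulate (proj₂ ∘ ∈-filter⁻ P? {xs = allFin n})) ,
  λ y Py → All.lookup (f[argmin]≤f[xs] x₀ candidates) (∈-filter⁺ P? (∈-allFin y) Py)
  where
  candidates : List (Fin n)
  candidates = filter P? (allFin n)

module IntervalColouring {n : ℕ} (G : IntervalGraph n) where
  open IntervalGraph G

  infix 4 _∋_ _∋?_

  _∋_ : Fin n → ℕ → Set
  i ∋ t = left i ≤ t × t ≤ right i

  _∋?_ : (i : Fin n) (t : ℕ) → Dec (i ∋ t)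
  i ∋? t = left i ≤? t ×-dec t ≤? right i

  clique : ℕ → Subset n
  clique t = tabulate (λ i → does (i ∋? t))

  lookup-clique : (t : ℕ) (i : Fin n) → lookup (clique t) i ≡ does (i ∋? t)
  lookup-clique t i = lookup∘tabulate (λ j → does (j ∋? t)) i

  ∋⇒∈clique : {i : Fin n} {t : ℕ} → i ∋ t → i ∈ clique t
  ∋⇒∈clique {i} {t} i∋t = lookup≡true⇒∈ (trans (lookup-clique t i) (dec-true (i ∋? t) i∋t))

  ∈clique⇒∋ : {i : Fin n} {t : ℕ} → i ∈ clique t → i ∋ t
  ∈clique⇒∋ {i} {t} i∈ =
    invert (subst (Reflects (i ∋ t)) (trans (sym (lookup-clique t i)) (∈⇒lookup≡true i∈))
                  (proof (i ∋? t)))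

  load : Subset n → ℕ → ℕ
  load X t = ∣ X ∩ clique t ∣

  LoadAtMost : ℕ → Subset n → Set
  LoadAtMost c X = ∀ t → load X t ≤ c

  load-mono : {X Y : Subset n} → X ⊆ Y → ∀ t → load X t ≤ load Y t
  load-mono {X} X⊆Y t = p⊆q⇒∣p∣≤∣q∣ λ i∈ →
    let i∈X , i∈clique = x∈p∩q⁻ X (clique t) i∈ in x∈p∩q⁺ (X⊆Y i∈X , i∈clique)

  0<load⇒witness : {X : Subset n} {t : ℕ} → 0 < load X t → ∃ λ i → i ∈ X × i ∋ t
  0<load⇒witness {X} {t} 0<load =
    let i , i∈ = 0<∣p∣⇒Nonempty (X ∩ clique t) 0<load
        i∈X , i∈clique = x∈p∩q⁻ X (clique t) i∈
    in i , i∈X , ∈clique⇒∋ i∈clique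

  ∈∧∋⇒0<load : {X : Subset n} {i : Fin n} {t : ℕ} → i ∈ X → i ∋ t → 0 < load X t
  ∈∧∋⇒0<load i∈X i∋t = x∈p⇒0<∣p∣ (x∈p∩q⁺ (i∈X , ∋⇒∈clique i∋t))

  module _ {X : Subset n} {x : Fin n} {t : ℕ} where

    𝟙[x∋t] : x ∋ t → 𝟙 (lookup (clique t) x) ≡ 1
    𝟙[x∋t] x∋t = cong 𝟙 (trans (lookup-clique t x) (dec-true (x ∋? t) x∋t))

    𝟙[x∌t] : ¬ x ∋ t → 𝟙 (lookup (clique t) x) ≡ 0
    𝟙[x∌t] x∌t = cong 𝟙 (trans (lookup-clique t x) (dec-false (x ∋? t) x∌t))

    load-remove-∋ : x ∈ X → x ∋ t → load X t ≡ suc (load (X - x) t)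
    load-remove-∋ x∈X x∋t = trans (∣p∩r∣≡∣p-x∩r∣+𝟙[x∈r] x∈X (clique t))
      (trans (cong (load (X - x) t +_) (𝟙[x∋t] x∋t)) (+-comm _ 1))

    load-remove-∌ : x ∈ X → ¬ x ∋ t → load X t ≡ load (X - x) t
    load-remove-∌ x∈X x∌t = trans (∣p∩r∣≡∣p-x∩r∣+𝟙[x∈r] x∈X (clique t))
      (trans (cong (load (X - x) t +_) (𝟙[x∌t] x∌t)) (+-identityʳ _))

    load-add-∋ : x ∉ X → x ∋ t → load (X ∪ ⁅ x ⁆) t ≡ suc (load X t)
    load-add-∋ x∉X x∋t = trans (∣p∪⁅x⁆∩r∣≡∣p∩r∣+𝟙[x∈r] x∉X (clique t))
      (trans (cong (load X t +_) (𝟙[x∋t] x∋t)) (+-comm _ 1))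

    load-add-∌ : x ∉ X → ¬ x ∋ t → load (X ∪ ⁅ x ⁆) t ≡ load X t
    load-add-∌ x∉X x∌t = trans (∣p∪⁅x⁆∩r∣≡∣p∩r∣+𝟙[x∈r] x∉X (clique t))
      (trans (cong (load X t +_) (𝟙[x∌t] x∌t)) (+-identityʳ _))

  ∋-shared⇒Adj : {i j : Fin n} {t : ℕ} → i ≢ j → i ∋ t → j ∋ t → Adj G i j
  ∋-shared⇒Adj i≢j (li≤t , t≤ri) (lj≤t , t≤rj) = i≢j , ≤-trans li≤t t≤rj , ≤-trans lj≤t t≤ri

  colorable⇒loadAtMost : {c : ℕ} {X : Subset n} → Colorable G c X → LoadAtMost c X
  colorable⇒loadAtMost {c} {X} (f , proper) t = begin
    load X t                 ≡⟨ +-identityʳ _ ⟨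
    load X t + 0             ≡⟨ cong (load X t +_) (∣⊥∣≡0 c) ⟨
    load X t + ∣ ⊥ {c} ∣     ≤⟨ injectiveOn∧avoids⇒∣p∣+∣q∣≤m (X ∩ clique t) ⊥ f injective (λ _ _ → ∉⊥) ⟩
    c                        ∎
    where
    open ≤-Reasoning
    injective : ∀ i j → i ∈ X ∩ clique t → j ∈ X ∩ clique t → i ≢ j → f i ≢ f j
    injective i j i∈ j∈ i≢j =
      let i∈X , i∈K = x∈p∩q⁻ X (clique t) i∈
          j∈X , j∈K = x∈p∩q⁻ X (clique t) j∈
      in proper i j i∈X j∈X (∋-shared⇒Adj i≢j (∈clique⇒∋ i∈K) (∈clique⇒∋ j∈K))

  -- All neighbours of x in X contain the point right x, so they use fewer than c colours.
  extend-colouring : {c : ℕ} {X : Subset n} {x : Fin n} → x ∈ X → (∀ y → y ∈ X → right x ≤ right y) →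
    LoadAtMost c X → Colorable G c (X - x) → Colorable G c X
  extend-colouring {c} {X} {x} x∈X x-first bounded (f , proper) = g , proper′
    where
    N : Subset n
    N = (X - x) ∩ clique (right x)
    ∣N∣<c : ∣ N ∣ + ∣ ⊥ {c} ∣ < c
    ∣N∣<c = begin-strict
      ∣ N ∣ + ∣ ⊥ {c} ∣   ≡⟨ cong (∣ N ∣ +_) (∣⊥∣≡0 c) ⟩
      ∣ N ∣ + 0           ≡⟨ +-identityʳ _ ⟩
      ∣ N ∣               <⟨ n<1+n _ ⟩
      suc ∣ N ∣           ≡⟨ load-remove-∋ x∈X (valid x , ≤-refl) ⟨
      load X (right x)    ≤⟨ bounded (right x) ⟩
      c                   ∎
      where open ≤-Reasoning
    unused : ∃ λ γ → γ ∉ ⊥ × (∀ i → i ∈ N → f i ≢ γ)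
    unused = ∣p∣+∣q∣<m⇒∃∉q∪f[p] N ⊥ f ∣N∣<c
    γ : Fin c
    γ = proj₁ unused
    g : Fin n → Fin c
    g = updateAt f x (const γ)
    g-x : g x ≡ γ
    g-x = updateAt-updates x f
    g-other : ∀ i → i ≢ x → g i ≡ f i
    g-other i i≢x = updateAt-minimal i x f i≢x
    neighbour-avoids-γ : ∀ j → j ∈ X → j ≢ x → left j ≤ right x → f j ≢ γ
    neighbour-avoids-γ j j∈X j≢x lj≤rx = proj₂ (proj₂ unused) j
      (x∈p∩q⁺ (x∈p∧x≢y⇒x∈p-y j∈X j≢x , ∋⇒∈clique (lj≤rx , x-first j j∈X)))
    proper′ : ∀ i j → i ∈ X → j ∈ X → Adj G i j → g i ≢ g j
    proper′ i j i∈X j∈X adj@(i≢j , li≤rj , lj≤ri) with i ≟ x | j ≟ x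
    ... | yes refl | yes refl = contradiction refl i≢j
    ... | yes refl | no  j≢x rewrite g-x | g-other j j≢x = neighbour-avoids-γ j j∈X j≢x lj≤ri ∘ sym
    ... | no  i≢x  | yes refl rewrite g-x | g-other i i≢x = neighbour-avoids-γ i i∈X i≢x li≤rj
    ... | no  i≢x  | no  j≢x rewrite g-other i i≢x | g-other j j≢x =
      proper i j (x∈p∧x≢y⇒x∈p-y i∈X i≢x) (x∈p∧x≢y⇒x∈p-y j∈X j≢x) adj

  loadAtMost⇒colorable : {c : ℕ} → 1 ≤ c → (X : Subset n) → LoadAtMost c X → Colorable G c X
  loadAtMost⇒colorable {c} 1≤c X = colour ∣ X ∣ X ≤-refl
    where
    colour : ∀ m X → ∣ X ∣ ≤ m → LoadAtMost c X → Colorable G c X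
    colour m X _ _ with nonempty? X
    colour m       X _     _       | no  empty =
      const (fromℕ< 1≤c) , λ i _ i∈X → contradiction (i , i∈X) empty
    colour zero    X ∣X∣≤0 _       | yes (x , x∈X) = contradiction (≤-trans (x∈p⇒0<∣p∣ x∈X) ∣X∣≤0) λ ()
    colour (suc m) X ∣X∣≤m bounded | yes nonempty =
      let x , x∈X , x-first = minimiser (_∈? X) right nonempty
      in extend-colouring x∈X x-first bounded
           (colour m (X - x) (≤-pred (≤-trans (x∈p⇒∣p-x∣<∣p∣ x∈X) ∣X∣≤m))
                   (λ t → ≤-trans (load-mono (p─q⊆p X ⁅ x ⁆) t) (bounded t)))

  load≡0 : {X : Subset n} {t : ℕ} → (∀ i → i ∈ X → ¬ i ∋ t) → load X t ≡ 0
  load≡0 none = n≤0⇒n≡0 (≮⇒≥ λ 0<load →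
    let i , i∈X , i∋t = 0<load⇒witness 0<load in none i i∈X i∋t)

  -- Instantiated with the points where X is at full load: there, a ∈ X may be traded for b
  -- exactly when a Shields b (see swap-loadAtMost).
  module Shielding (Marked : ℕ → Set) where

    infix 4 _≼_

    _≼_ : Subset n → Subset n → Set
    Q ≼ P = ∀ t → Marked t → load Q t ≤ load P t

    _Shields_ : Fin n → Fin n → Set
    a Shields b = ∀ t → Marked t → b ∋ t → a ∋ t

    Unmarked : Fin n → Set
    Unmarked b = ∀ t → Marked t → ¬ b ∋ t

    ShieldedBy : Subset n → Fin n → Set
    ShieldedBy P b = Unmarked b ⊎ ∃ λ a → a ∈ P × a Shields b

    ShieldedBy-mono : {P P′ : Subset n} {b : Fin n} → P ⊆ P′ → ShieldedBy P b → ShieldedBy P′ b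
    ShieldedBy-mono P⊆P′ (inj₁ unmarked)           = inj₁ unmarked
    ShieldedBy-mono P⊆P′ (inj₂ (a , a∈P , shields)) = inj₂ (a , P⊆P′ a∈P , shields)

    ≼-witness : {P Q : Subset n} {b : Fin n} {t : ℕ} → Q ≼ P → b ∈ Q → Marked t → b ∋ t →
      ∃ λ a → a ∈ P × a ∋ t
    ≼-witness Q≼P b∈Q marked b∋t = 0<load⇒witness (≤-trans (∈∧∋⇒0<load b∈Q b∋t) (Q≼P _ marked))

    shielded-if-ends-first : {P Q : Subset n} {b : Fin n} → Q ≼ P → b ∈ Q →
      (∀ a → a ∈ P → right b ≤ right a) → ShieldedBy P b
    shielded-if-ends-first {P} {Q} {b} Q≼P b∈Q b-first
      with any? (λ a → a ∈? P ×-dec left a ≤? right b)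
    ... | no ¬meets = inj₁ λ t marked b∋t →
      let a , a∈P , (la≤t , _) = ≼-witness Q≼P b∈Q marked b∋t
      in ¬meets (a , a∈P , ≤-trans la≤t (proj₂ b∋t))
    ... | yes meets =
      let a* , (a*∈P , _) , a*-first = minimiser (λ a → a ∈? P ×-dec left a ≤? right b) left meets
      in inj₂ (a* , a*∈P , λ t marked b∋t →
        let a , a∈P , (la≤t , _) = ≼-witness Q≼P b∈Q marked b∋t
        in ≤-trans (a*-first a (a∈P , ≤-trans la≤t (proj₂ b∋t))) la≤t ,
           ≤-trans (proj₂ b∋t) (b-first a* a*∈P))

    ≼-remove-unmet : {P Q : Subset n} {a : Fin n} → a ∈ P → (∀ b → b ∈ Q → ¬ left b ≤ right a) →
      Q ≼ P → Q ≼ P - a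
    ≼-remove-unmet {P} {Q} {a} a∈P unmet Q≼P t marked with a ∋? t
    ... | yes (_ , t≤ra) =
      subst (_≤ load (P - a) t) (sym (load≡0 λ b b∈Q (lb≤t , _) → unmet b b∈Q (≤-trans lb≤t t≤ra))) z≤n
    ... | no  a∌t = ≤-trans (Q≼P t marked) (≤-reflexive (load-remove-∌ a∈P a∌t))

    ≼-remove-pair : {P Q : Subset n} {a b : Fin n} → a ∈ P → b ∈ Q →
      (∀ b′ → b′ ∈ Q → right a < right b′) → (∀ b′ → b′ ∈ Q × left b′ ≤ right a → left b ≤ left b′) →
      Q ≼ P → Q - b ≼ P - a
    ≼-remove-pair {P} {Q} {a} {b} a∈P b∈Q a-first b-first Q≼P t marked with a ∋? t | b ∋? t
    ... | no  a∌t | _ = begin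
      load (Q - b) t   ≤⟨ load-mono (p─q⊆p Q ⁅ b ⁆) t ⟩
      load Q t         ≤⟨ Q≼P t marked ⟩
      load P t         ≡⟨ load-remove-∌ a∈P a∌t ⟩
      load (P - a) t   ∎
      where open ≤-Reasoning
    ... | yes a∋t | yes b∋t =
      ≤-pred (subst₂ _≤_ (load-remove-∋ b∈Q b∋t) (load-remove-∋ a∈P a∋t) (Q≼P t marked))
    ... | yes (_ , t≤ra) | no b∌t = subst (_≤ load (P - a) t) (sym (load≡0 missed)) z≤n
      where
      missed : ∀ b′ → b′ ∈ Q - b → ¬ b′ ∋ t
      missed b′ b′∈Q-b (lb′≤t , _) =
        let b′∈Q = p─q⊆p Q ⁅ b ⁆ b′∈Q-b
        in b∌t (≤-trans (b-first b′ (b′∈Q , ≤-trans lb′≤t t≤ra)) lb′≤t ,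
                <⇒≤ (≤-<-trans t≤ra (a-first b b∈Q)))

    shields-if-sole : {P Q : Subset n} {a b : Fin n} → ∣ P - a ∣ ≡ 0 → Q ≼ P → b ∈ Q → a Shields b
    shields-if-sole {P} {Q} {a} ∣P-a∣≡0 Q≼P b∈Q t marked b∋t
      with a′ , a′∈P , a′∋t ← ≼-witness {P = P} Q≼P b∈Q marked b∋t
      with a′ ≟ a
    ... | yes refl = a′∋t
    ... | no  a′≢a = contradiction (subst (0 <_) ∣P-a∣≡0 (x∈p⇒0<∣p∣ (x∈p∧x≢y⇒x∈p-y a′∈P a′≢a))) λ ()

    -- A sweep from the left: either an interval of Q ends first, and is then shielded, or
    -- some a ∈ P ends before all of Q; then a is dropped together with the interval of Q
    -- that meets it and starts first (if any), which preserves Q ≼ P.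
    shielded-exists : ∀ m {P Q : Subset n} → ∣ P ∣ ≤ m → ∣ P ∣ ≤ ∣ Q ∣ → Q ≼ P → Nonempty Q →
      ∃ λ b → b ∈ Q × ShieldedBy P b
    shielded-exists-after : ∀ m {P Q : Subset n} {a : Fin n} → a ∈ P →
      (∀ b → b ∈ Q → right a < right b) → ∣ P ∣ ≤ suc m → ∣ P ∣ ≤ ∣ Q ∣ → Q ≼ P → Nonempty Q →
      ∃ λ b → b ∈ Q × ShieldedBy P b

    shielded-exists m {P} {Q} ∣P∣≤m ∣P∣≤∣Q∣ Q≼P Q≢∅
      with b₀ , b₀∈Q , b₀-first ← minimiser (_∈? Q) right Q≢∅
      with any? (λ a → a ∈? P ×-dec right a <? right b₀) | m
    ... | no ¬earlier | _ = b₀ , b₀∈Q ,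
      shielded-if-ends-first Q≼P b₀∈Q λ a a∈P → ≮⇒≥ λ ra<rb₀ → ¬earlier (a , a∈P , ra<rb₀)
    ... | yes (a , a∈P , _) | zero = contradiction (≤-trans (x∈p⇒0<∣p∣ a∈P) ∣P∣≤m) λ ()
    ... | yes (a , a∈P , ra<rb₀) | suc m′ = shielded-exists-after m′ a∈P
      (λ b b∈Q → <-≤-trans ra<rb₀ (b₀-first b b∈Q)) ∣P∣≤m ∣P∣≤∣Q∣ Q≼P Q≢∅

    shielded-exists-after m {P} {Q} {a} a∈P a-first ∣P∣≤1+m ∣P∣≤∣Q∣ Q≼P Q≢∅
      with any? (λ b → b ∈? Q ×-dec left b ≤? right a)
    ... | no ¬meets =
      let b , b∈Q , shielded = shielded-exists m ∣P-a∣≤m (≤-trans (<⇒≤ (x∈p⇒∣p-x∣<∣p∣ a∈P)) ∣P∣≤∣Q∣)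
            (≼-remove-unmet a∈P (λ b b∈Q lb≤ra → ¬meets (b , b∈Q , lb≤ra)) Q≼P) Q≢∅
      in b , b∈Q , ShieldedBy-mono (p─q⊆p P ⁅ a ⁆) shielded
      where
      ∣P-a∣≤m : ∣ P - a ∣ ≤ m
      ∣P-a∣≤m = ≤-pred (≤-trans (x∈p⇒∣p-x∣<∣p∣ a∈P) ∣P∣≤1+m)
    ... | yes meets
      with b , (b∈Q , _) , b-first ← minimiser (λ b → b ∈? Q ×-dec left b ≤? right a) left meets
      with nonempty? (Q - b)
    ... | yes Q-b≢∅ =
      let b′ , b′∈Q-b , shielded = shielded-exists m ∣P-a∣≤m (∣p∣≤∣q∣⇒∣p-x∣≤∣q-y∣ a∈P b∈Q ∣P∣≤∣Q∣)
            (≼-remove-pair a∈P b∈Q a-first b-first Q≼P) Q-b≢∅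
      in b′ , p─q⊆p Q ⁅ b ⁆ b′∈Q-b , ShieldedBy-mono (p─q⊆p P ⁅ a ⁆) shielded
      where
      ∣P-a∣≤m : ∣ P - a ∣ ≤ m
      ∣P-a∣≤m = ≤-pred (≤-trans (x∈p⇒∣p-x∣<∣p∣ a∈P) ∣P∣≤1+m)
    ... | no Q-b≡∅ = b , b∈Q , inj₂ (a , a∈P , shields-if-sole {P} ∣P-a∣≡0 Q≼P b∈Q)
      where
      ∣P-a∣≡0 : ∣ P - a ∣ ≡ 0
      ∣P-a∣≡0 = n≤0⇒n≡0 (subst (∣ P - a ∣ ≤_) (trans (cong ∣_∣ (Empty-unique Q-b≡∅)) (∣⊥∣≡0 n))
                                (∣p∣≤∣q∣⇒∣p-x∣≤∣q-y∣ a∈P b∈Q ∣P∣≤∣Q∣))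

  swap-loadAtMost : {c : ℕ} {X : Subset n} {a b : Fin n} → a ∈ X → b ∉ X → LoadAtMost c X →
    (∀ t → load X t ≡ c → b ∋ t → a ∋ t) → LoadAtMost c ((X - a) ∪ ⁅ b ⁆)
  swap-loadAtMost {c} {X} {a} {b} a∈X b∉X bounded shields t = bound (b ∋? t) (a ∋? t)
    where
    open ≤-Reasoning
    b∉X-a : b ∉ X - a
    b∉X-a = b∉X ∘ p─q⊆p X ⁅ a ⁆
    bound : Dec (b ∋ t) → Dec (a ∋ t) → load ((X - a) ∪ ⁅ b ⁆) t ≤ c
    bound (no b∌t) _ = begin
      load ((X - a) ∪ ⁅ b ⁆) t   ≡⟨ load-add-∌ b∉X-a b∌t ⟩
      load (X - a) t             ≤⟨ load-mono (p─q⊆p X ⁅ a ⁆) t ⟩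
      load X t                   ≤⟨ bounded t ⟩
      c                          ∎
    bound (yes b∋t) (yes a∋t) = begin
      load ((X - a) ∪ ⁅ b ⁆) t   ≡⟨ load-add-∋ b∉X-a b∋t ⟩
      suc (load (X - a) t)       ≡⟨ load-remove-∋ a∈X a∋t ⟨
      load X t                   ≤⟨ bounded t ⟩
      c                          ∎
    bound (yes b∋t) (no a∌t) = begin
      load ((X - a) ∪ ⁅ b ⁆) t   ≡⟨ load-add-∋ b∉X-a b∋t ⟩
      suc (load (X - a) t)       ≡⟨ cong suc (load-remove-∌ a∈X a∌t) ⟨
      suc (load X t)             ≤⟨ ≤∧≢⇒< (bounded t) (λ full → a∌t (shields t full b∋t)) ⟩
      c                          ∎

  exchange : {c : ℕ} {X T : Subset n} → 1 ≤ c → Colorable G c X → Colorable G c T →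
    ∣ X ∣ ≡ ∣ T ∣ → X ≢ T →
    ∃₂ λ a b → a ∈ X × a ∉ T × b ∈ T × b ∉ X × Colorable G c ((X - a) ∪ ⁅ b ⁆)
  exchange {c} {X} {T} 1≤c colX colT ∣X∣≡∣T∣ X≢T =
    swap (shielded-exists ∣ X ─ T ∣ ≤-refl (≤-reflexive ∣P∣≡∣Q∣) Q≼P Q≢∅)
    where
    open Shielding (λ t → load X t ≡ c)
    ∣P∣≡∣Q∣ : ∣ X ─ T ∣ ≡ ∣ T ─ X ∣
    ∣P∣≡∣Q∣ = ∣p∣≡∣q∣⇒∣p─q∣≡∣q─p∣ X T ∣X∣≡∣T∣
    Q≢∅ : Nonempty (T ─ X)
    Q≢∅ = ∣p∣≡∣q∣∧p≢q⇒Nonempty[q─p] X T ∣X∣≡∣T∣ X≢T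
    P≢∅ : Nonempty (X ─ T)
    P≢∅ = 0<∣p∣⇒Nonempty (X ─ T) (subst (0 <_) (sym ∣P∣≡∣Q∣) (x∈p⇒0<∣p∣ (proj₂ Q≢∅)))
    Q≼P : T ─ X ≼ X ─ T
    Q≼P t full = +-cancelˡ-≤ ∣ (X ∩ T) ∩ clique t ∣ _ _ (begin
      ∣ (X ∩ T) ∩ clique t ∣ + load (T ─ X) t   ≡⟨ cong (λ s → ∣ s ∩ clique t ∣ + load (T ─ X) t) (∩-comm X T) ⟩
      ∣ (T ∩ X) ∩ clique t ∣ + load (T ─ X) t   ≡⟨ ∣p∩r∣≡∣p∩q∩r∣+∣p─q∩r∣ T X (clique t) ⟨
      load T t                                  ≤⟨ colorable⇒loadAtMost colT t ⟩
      c                                         ≡⟨ full ⟨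
      load X t                                  ≡⟨ ∣p∩r∣≡∣p∩q∩r∣+∣p─q∩r∣ X T (clique t) ⟩
      ∣ (X ∩ T) ∩ clique t ∣ + load (X ─ T) t   ∎)
      where open ≤-Reasoning
    shielder : {b : Fin n} → ShieldedBy (X ─ T) b → ∃ λ a → a ∈ X ─ T × a Shields b
    shielder (inj₁ unmarked) = proj₁ P≢∅ , proj₂ P≢∅ , λ t full b∋t → contradiction b∋t (unmarked t full)
    shielder (inj₂ shielded) = shielded
    swap : (∃ λ b → b ∈ T ─ X × ShieldedBy (X ─ T) b) →
      ∃₂ λ a b → a ∈ X × a ∉ T × b ∈ T × b ∉ X × Colorable G c ((X - a) ∪ ⁅ b ⁆)
    swap (b , b∈Q , shielded) with a , a∈P , a-shields-b ← shielder shielded =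
      a , b , p─q⊆p X T a∈P , x∈p─q⇒x∉q a∈P , p─q⊆p T X b∈Q , x∈p─q⇒x∉q b∈Q ,
      loadAtMost⇒colorable 1≤c ((X - a) ∪ ⁅ b ⁆)
        (swap-loadAtMost (p─q⊆p X T a∈P) (x∈p─q⇒x∉q b∈Q) (colorable⇒loadAtMost colX) a-shields-b)

module TAR {n : ℕ} (G : IntervalGraph n) (c k : ℕ) where

  private variable
    S S′ T U X : Subset n
    x : Fin n
    ℓ : ℕ

  colorable-⊆ : X ⊆ T → Colorable G c T → Colorable G c X
  colorable-⊆ X⊆T (f , proper) = f , λ i j i∈X j∈X → proper i j (X⊆T i∈X) (X⊆T j∈X)

  origin-colorable : TARSeq G c k S U ℓ → Colorable G c S
  origin-colorable (start colS)  = colS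
  origin-colorable (step seq _ _) = origin-colorable seq

  uncons : TARSeq G c k S U (suc ℓ) → ∃ λ X → TARStep G k S X × TARSeq G c k X U ℓ
  uncons (step (start _) colU S→U) = _ , S→U , start colU
  uncons (step seq@(step _ _ _) colU T→U) with X , S→X , X⇝T ← uncons seq =
    X , S→X , step X⇝T colU T→U

  ∣⊖∣≤length : TARSeq G c k S U ℓ → ∣ S ⊖ U ∣ ≤ ℓ
  ∣⊖∣≤length {S} (start _) = ≤-reflexive (∣p⊖p∣≡0 S)
  ∣⊖∣≤length {S} {U} {suc ℓ} (step {T} seq _ (_ , _ , ∣T⊖U∣≡1)) = begin
    ∣ S ⊖ U ∣               ≤⟨ ∣p⊖r∣≤∣p⊖q∣+∣q⊖r∣ S T U ⟩
    ∣ S ⊖ T ∣ + ∣ T ⊖ U ∣   ≤⟨ +-mono-≤ (∣⊖∣≤length seq) (≤-reflexive ∣T⊖U∣≡1) ⟩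
    ℓ + 1                   ≡⟨ +-comm ℓ 1 ⟩
    suc ℓ                   ∎
    where open ≤-Reasoning

  locked-extension⇒∉ : LockedIn G c k (S ∪ S′) S → x ∉ S → Colorable G c (S ∪ ⁅ x ⁆) → x ∉ S′
  locked-extension⇒∉ {S} {S′} {x} (_ , _ , maximal , _) x∉S colS+x x∈S′ =
    x∉S (maximal (S ∪ ⁅ x ⁆) (p⊆p∪q ⁅ x ⁆) S+x⊆S∪S′ colS+x (x∈p∪⁅x⁆ S))
    where
    S+x⊆S∪S′ : S ∪ ⁅ x ⁆ ⊆ S ∪ S′
    S+x⊆S∪S′ i∈ with x∈p∪q⁻ S ⁅ x ⁆ i∈
    ... | inj₁ i∈S   = p⊆p∪q S′ i∈S
    ... | inj₂ i∈⁅x⁆ = q⊆p∪q S S′ (subst (_∈ S′) (sym (x∈⁅y⁆⇒x≡y x i∈⁅x⁆)) x∈S′)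

  lower-bound : S ≢ S′ → LockedIn G c k (S ∪ S′) S → TARSeq G c k S S′ ℓ → ∣ S ⊖ S′ ∣ + 2 ≤ ℓ
  lower-bound S≢S′ _ (start _) = contradiction refl S≢S′
  lower-bound {S} {S′} {suc ℓ} S≢S′ locked@(_ , _ , _ , ∣S∣≡k) seq@(step _ _ _)
    with X , (_ , k≤∣X∣ , ∣S⊖X∣≡1) , X⇝S′ ← uncons seq
    with x , x∉S , refl ←
         ∣p∣≤∣q∣∧∣p⊖q∣≡1⇒q≡p∪⁅x⁆ {p = S} (subst (_≤ ∣ X ∣) (sym ∣S∣≡k) k≤∣X∣) ∣S⊖X∣≡1 = begin
    ∣ S ⊖ S′ ∣ + 2              ≡⟨ +-comm _ 2 ⟩
    suc (suc ∣ S ⊖ S′ ∣)        ≡⟨ cong suc (∣p∪⁅x⁆⊖q∣≡1+∣p⊖q∣ x∉S x∉S′) ⟨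
    suc ∣ (S ∪ ⁅ x ⁆) ⊖ S′ ∣    ≤⟨ s≤s (∣⊖∣≤length X⇝S′) ⟩
    suc ℓ                       ∎
    where
    open ≤-Reasoning
    x∉S′ : x ∉ S′
    x∉S′ = locked-extension⇒∉ locked x∉S (origin-colorable X⇝S′)

  remove-step : x ∈ X → ∣ X ∣ ≡ suc k → TARStep G k X (X - x)
  remove-step {x} {X} x∈X ∣X∣≡1+k =
    subst (k ≤_) (sym ∣X∣≡1+k) (n≤1+n k) ,
    ≤-reflexive (sym (suc-injective (trans (sym (∣p∣≡1+∣p-x∣ x∈X)) ∣X∣≡1+k))) ,
    ∣p⊖p-x∣≡1 x∈X

  add-step : x ∉ X → ∣ X ∣ ≡ k → TARStep G k X (X ∪ ⁅ x ⁆)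
  add-step x∉X ∣X∣≡k =
    ≤-reflexive (sym ∣X∣≡k) ,
    subst (k ≤_) (sym (trans (∣p∪⁅x⁆∣≡1+∣p∣ x∉X) (cong suc ∣X∣≡k))) (n≤1+n k) ,
    ∣p⊖p∪⁅x⁆∣≡1 x∉X

  unadd-step : x ∉ X → ∣ X ∣ ≡ k → TARStep G k (X ∪ ⁅ x ⁆) X
  unadd-step {x} {X} x∉X ∣X∣≡k =
    let k≤∣X∣ , k≤∣X+x∣ , ∣X⊖X+x∣≡1 = add-step x∉X ∣X∣≡k
    in k≤∣X+x∣ , k≤∣X∣ , trans (∣p⊖q∣≡∣q⊖p∣ (X ∪ ⁅ x ⁆) X) ∣X⊖X+x∣≡1

  ⊖-nonzero⇒≢ : ∀ {d} → ∣ X ⊖ T ∣ ≡ suc d → X ≢ T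
  ⊖-nonzero⇒≢ {X} {T} ∣X⊖T∣≡1+d refl = 0≢1+n (trans (sym (∣p⊖p∣≡0 X)) ∣X⊖T∣≡1+d)

  module _ (1≤c : 1 ≤ c) (colT : Colorable G c T) (∣T∣≡1+k : ∣ T ∣ ≡ suc k) where

    ExchangeStep : Subset n → Set
    ExchangeStep X = ∃ λ X′ → Colorable G c X′ × ∣ X′ ∣ ≡ suc k × suc (suc ∣ X′ ⊖ T ∣) ≡ ∣ X ⊖ T ∣ ×
                              (∀ {S ℓ} → TARSeq G c k S X ℓ → TARSeq G c k S X′ (suc (suc ℓ)))

    exchange-steps : X ≢ T → Colorable G c X → ∣ X ∣ ≡ suc k → ExchangeStep X
    exchange-steps {X} X≢T colX ∣X∣≡1+k =
      swap (IntervalColouring.exchange G 1≤c colX colT (trans ∣X∣≡1+k (sym ∣T∣≡1+k)) X≢T)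
      where
      swap : (∃₂ λ a b → a ∈ X × a ∉ T × b ∈ T × b ∉ X × Colorable G c ((X - a) ∪ ⁅ b ⁆)) →
        ExchangeStep X
      swap (a , b , a∈X , a∉T , b∈T , b∉X , colX′) =
        (X - a) ∪ ⁅ b ⁆ , colX′ , trans (∣p∪⁅x⁆∣≡1+∣p∣ b∉X-a) (cong suc ∣X-a∣≡k) ,
        sym (trans (∣p⊖q∣≡1+∣p-x⊖q∣ a∈X a∉T) (cong suc (∣p⊖q∣≡1+∣p∪⁅x⁆⊖q∣ b∉X-a b∈T))) ,
        λ seq → step (step seq (colorable-⊆ (p─q⊆p X ⁅ a ⁆) colX) (remove-step a∈X ∣X∣≡1+k))
                     colX′ (add-step b∉X-a ∣X-a∣≡k)
        where
        b∉X-a : b ∉ X - a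
        b∉X-a = b∉X ∘ p─q⊆p X ⁅ a ⁆
        ∣X-a∣≡k : ∣ X - a ∣ ≡ k
        ∣X-a∣≡k = suc-injective (trans (sym (∣p∣≡1+∣p-x∣ a∈X)) ∣X∣≡1+k)

    walk : ∀ d {X S : Subset n} {ℓ : ℕ} → Colorable G c X → ∣ X ∣ ≡ suc k → ∣ X ⊖ T ∣ ≡ d →
      TARSeq G c k S X ℓ → TARSeq G c k S T (ℓ + d)
    walk zero {X} {S} {ℓ} _ _ ∣X⊖T∣≡0 seq =
      subst₂ (TARSeq G c k S) (∣p⊖q∣≡0⇒p≡q X T ∣X⊖T∣≡0) (sym (+-identityʳ ℓ)) seq
    walk (suc zero) colX ∣X∣≡1+k ∣X⊖T∣≡1 _ =
      let _ , _ , _ , shrinks , _ = exchange-steps (⊖-nonzero⇒≢ ∣X⊖T∣≡1) colX ∣X∣≡1+k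
      in contradiction (suc-injective (trans shrinks ∣X⊖T∣≡1)) λ ()
    walk (suc (suc d)) {X} {S} {ℓ} colX ∣X∣≡1+k ∣X⊖T∣≡2+d seq =
      let X′ , colX′ , ∣X′∣≡1+k , shrinks , extend =
            exchange-steps (⊖-nonzero⇒≢ ∣X⊖T∣≡2+d) colX ∣X∣≡1+k
          ∣X′⊖T∣≡d : ∣ X′ ⊖ T ∣ ≡ d
          ∣X′⊖T∣≡d = suc-injective (suc-injective (trans shrinks ∣X⊖T∣≡2+d))
      in subst (TARSeq G c k S T) (sym (trans (+-suc ℓ (suc d)) (cong suc (+-suc ℓ d))))
           (walk d colX′ ∣X′∣≡1+k ∣X′⊖T∣≡d (extend seq))

  upper-bound : 1 ≤ c → x ∉ S → x ∉ S′ → Colorable G c S → Colorable G c S′ →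
    Colorable G c (S ∪ ⁅ x ⁆) → Colorable G c (S′ ∪ ⁅ x ⁆) → ∣ S ∣ ≡ k → ∣ S′ ∣ ≡ k →
    TARSeq G c k S S′ (∣ S ⊖ S′ ∣ + 2)
  upper-bound {x} {S} {S′} 1≤c x∉S x∉S′ colS colS′ colS+x colS′+x ∣S∣≡k ∣S′∣≡k =
    subst (TARSeq G c k S S′) length
      (step (walk 1≤c colS′+x ∣S′+x∣≡1+k d colS+x ∣S+x∣≡1+k refl
                  (step (start colS) colS+x (add-step x∉S ∣S∣≡k)))
            colS′ (unadd-step x∉S′ ∣S′∣≡k))
    where
    d : ℕ
    d = ∣ (S ∪ ⁅ x ⁆) ⊖ (S′ ∪ ⁅ x ⁆) ∣
    ∣S+x∣≡1+k : ∣ S ∪ ⁅ x ⁆ ∣ ≡ suc k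
    ∣S+x∣≡1+k = trans (∣p∪⁅x⁆∣≡1+∣p∣ x∉S) (cong suc ∣S∣≡k)
    ∣S′+x∣≡1+k : ∣ S′ ∪ ⁅ x ⁆ ∣ ≡ suc k
    ∣S′+x∣≡1+k = trans (∣p∪⁅x⁆∣≡1+∣p∣ x∉S′) (cong suc ∣S′∣≡k)
    length : suc (1 + d) ≡ ∣ S ⊖ S′ ∣ + 2
    length = trans (+-comm 2 d) (cong (_+ 2) (∣p∪⁅x⁆⊖q∪⁅x⁆∣≡∣p⊖q∣ x∉S x∉S′))

lemma11 : ∀ {n} (G : IntervalGraph n) (c k : ℕ) → 1 ≤ c →
    (S S′ : Subset n) → S ≢ S′ →
    Colorable G c S → Colorable G c S′ →
    k ≤ ∣ S ∣ → k ≤ ∣ S′ ∣ →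
    LockedIn G c k (S ∪ S′) S → LockedIn G c k (S ∪ S′) S′ →
    ¬ LockedIn G c k ⊤ S → ¬ LockedIn G c k ⊤ S′ →
    Σ (Fin n) (λ v → v ∉ (S ∪ S′) × Colorable G c (S ∪ ⁅ v ⁆) × Colorable G c (S′ ∪ ⁅ v ⁆)) →
    DistTAR≡ G c k S S′ (∣ _△_ G S S′ ∣ + 2)
-- k ≤ ∣ S ∣ and k ≤ ∣ S′ ∣ follow from lockedness in G[S ∪ S′], and neither set is locked in G
-- since v extends both.
lemma11 G c k 1≤c S S′ S≢S′ colS colS′ _ _ lockedS lockedS′ _ _ (v , v∉S∪S′ , colS+v , colS′+v) =
  upper-bound 1≤c (v∉S∪S′ ∘ p⊆p∪q S′) (v∉S∪S′ ∘ q⊆p∪q S S′) colS colS′ colS+v colS′+v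
    (size lockedS) (size lockedS′) ,
  λ ℓ → lower-bound S≢S′ lockedS
  where
  open TAR G c k
  size : ∀ {U X} → LockedIn G c k U X → ∣ X ∣ ≡ k
  size (_ , _ , _ , ∣X∣≡k) = ∣X∣≡k
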